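{- Let $K$ be a field with a non-trivial valuation $v$ and let $A(x)=\sum_{i=0}^n a_ix^i\in K[x]$ be a polynomial of degree $n$. Then $A$ satisfies conditions (D0), (D1), (D2) if and only if it satisfies (D0), (D1), (D2'), where (D0) $a_0a_n\neq0$; (D1) $v(a_0)-v(a_n)\notin k\Gamma=\{kg:g\in\Gamma\}$ for every integer $k>1$ dividing $n$; (D2) $nv(a_i)\ge (n-i)v(a_0)+iv(a_n)$ for $0\le i\le n$; (D2') $nv(a_i)> (n-i)v(a_0)+iv(a_n)$ for $1\le i\le n-1$.
   Context: $v:K\to\Gamma\cup\{\infty\}$ is a non-trivial Krull valuation on $K$ with values in a linearly ordered abelian group $\Gamma$ (with $\infty$ greater than every element of $\Gamma$ and $g+\infty=\infty$): $v(a)=\infty$ iff $a=0$, $v(ab)=v(a)+v(b)$, $v(a+b)\ge\min\{v(a),v(b)\}$. -}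

module Defs where

open import Level using (Level; _⊔_; Lift) renaming (suc to lsuc)
open import Data.Empty using (⊥)
open import Data.Unit using (⊤)
open import Algebra.Bundles using (CommutativeRing; AbelianGroup)
import Algebra.Definitions.RawMonoid as RawMonoidDefs
open import Relation.Binary.Core using (Rel)
open import Relation.Binary.Structures using (IsTotalOrder)
open import Relation.Nullary using (¬_)
open import Data.Product using (∃; _×_; _,_)
open import Data.Sum using (_⊎_)
open import Data.Nat as ℕ using (ℕ; _∸_)
open import Data.Nat.Divisibility using (_∣_)
open import Data.Fin as Fin using (Fin; fromℕ; toℕ)

record Field c ℓ : Set (lsuc (c ⊔ ℓ)) where
  field
    commutativeRing : CommutativeRing c ℓ
  open CommutativeRing commutativeRing public
  field
    1≉0     : ¬ (1# ≈ 0#)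
    inverse : ∀ x → ¬ (x ≈ 0#) → ∃ λ y → (x * y) ≈ 1#

-- A linearly ordered abelian group (written multiplicatively by the
-- library: _∙_, ε, _⁻¹; read additively: +, 0, -).
record LinearlyOrderedAbelianGroup c ℓ₁ ℓ₂ : Set (lsuc (c ⊔ ℓ₁ ⊔ ℓ₂)) where
  field
    abelianGroup : AbelianGroup c ℓ₁
  open AbelianGroup abelianGroup public
  field
    _≤_          : Rel Carrier ℓ₂
    isTotalOrder : IsTotalOrder _≈_ _≤_
    ∙-mono-≤     : ∀ {x y} z → x ≤ y → (x ∙ z) ≤ (y ∙ z)
  open RawMonoidDefs rawMonoid public using () renaming (_×_ to _·_)

module Extended {c ℓ₁ ℓ₂} (Γ : LinearlyOrderedAbelianGroup c ℓ₁ ℓ₂) where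
  open LinearlyOrderedAbelianGroup Γ

  data Γ∞ : Set c where
    fin : Carrier → Γ∞
    ∞   : Γ∞

  _≈∞_ : Γ∞ → Γ∞ → Set ℓ₁
  fin a ≈∞ fin b = a ≈ b
  fin a ≈∞ ∞     = Lift ℓ₁ ⊥
  ∞     ≈∞ fin b = Lift ℓ₁ ⊥
  ∞     ≈∞ ∞     = Lift ℓ₁ ⊤

  _≤∞_ : Γ∞ → Γ∞ → Set ℓ₂
  fin a ≤∞ fin b = a ≤ b
  fin a ≤∞ ∞     = Lift ℓ₂ ⊤
  ∞     ≤∞ fin b = Lift ℓ₂ ⊥
  ∞     ≤∞ ∞     = Lift ℓ₂ ⊤

  _<∞_ : Γ∞ → Γ∞ → Set (ℓ₁ ⊔ ℓ₂)
  x <∞ y = (x ≤∞ y) × ¬ (x ≈∞ y)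

  _+∞_ : Γ∞ → Γ∞ → Γ∞
  fin a +∞ fin b = fin (a ∙ b)
  fin a +∞ ∞     = ∞
  ∞     +∞ _     = ∞

  _×∞_ : ℕ → Γ∞ → Γ∞
  k ×∞ fin a = fin (k · a)
  k ×∞ ∞     = ∞

record Valuation {c ℓ c' ℓ₁ ℓ₂} (K : Field c ℓ)
                 (Γ : LinearlyOrderedAbelianGroup c' ℓ₁ ℓ₂)
                 : Set (c ⊔ ℓ ⊔ c' ⊔ ℓ₁ ⊔ ℓ₂) where
  open Field K
  open LinearlyOrderedAbelianGroup Γ using (ε)
  open Extended Γ
  field
    v          : Carrier → Γ∞
    v-cong     : ∀ {a b} → a ≈ b → v a ≈∞ v b
    v-∞⇒0      : ∀ a → v a ≈∞ ∞ → a ≈ 0#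
    0⇒v-∞      : ∀ a → a ≈ 0# → v a ≈∞ ∞
    v-*        : ∀ a b → v (a * b) ≈∞ (v a +∞ v b)
    v-+        : ∀ a b → (v a ≤∞ v (a + b)) ⊎ (v b ≤∞ v (a + b))
    nontrivial : ∃ λ a → ¬ (a ≈ 0#) × ¬ (v a ≈∞ fin ε)

module Conditions {c ℓ c' ℓ₁ ℓ₂} {K : Field c ℓ}
                  {Γ : LinearlyOrderedAbelianGroup c' ℓ₁ ℓ₂}
                  (V : Valuation K Γ) where
  open Field K renaming (Carrier to K₀; _≈_ to _≈K_)
  open LinearlyOrderedAbelianGroup Γ
  open Extended Γ
  open Valuation V

  module _ (n : ℕ) (a : Fin (ℕ.suc n) → K₀) where
    a₀ aₙ : K₀
    a₀ = a Fin.zero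
    aₙ = a (fromℕ n)

    D0 : Set ℓ
    D0 = ¬ ((a₀ * aₙ) ≈K 0#)

    D1 : Set (c' ⊔ ℓ₁)
    D1 = ∀ g h → v a₀ ≈∞ fin g → v aₙ ≈∞ fin h →
         ∀ k → 1 ℕ.< k → k ∣ n →
         ¬ (∃ λ γ → (g ∙ (h ⁻¹)) ≈ (k · γ))

    D2 : Set ℓ₂
    D2 = ∀ (i : Fin (ℕ.suc n)) →
         (((n ∸ toℕ i) ×∞ v a₀) +∞ (toℕ i ×∞ v aₙ)) ≤∞ (n ×∞ v (a i))

    D2′ : Set (ℓ₁ ⊔ ℓ₂)
    D2′ = ∀ (i : Fin (ℕ.suc n)) → 1 ℕ.≤ toℕ i → toℕ i ℕ.< n →
          (((n ∸ toℕ i) ×∞ v a₀) +∞ (toℕ i ×∞ v aₙ)) <∞ (n ×∞ v (a i))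

{-# OPTIONS --safe #-}
-- Only the interior indices matter: at i = 0 and i = n both sides of (D2)
-- agree. For 0 < i < n, equality (n - i) v(a₀) + i v(aₙ) = n v(aᵢ) says that
-- (n - i) δ lies in nΓ, where δ = v(a₀) - v(aₙ). Bézout then puts d δ in nΓ
-- for d = gcd(n, n - i), and since Γ is torsion-free, dividing by d puts δ in
-- (n/d)Γ. As 0 < d < n, the integer k = n/d > 1 divides n, against (D1).
module Submission where

open import Defs
open import Level using (_⊔_; lift)
open import Data.Empty using (⊥-elim)
open import Data.Unit using (tt)
open import Data.Product using (∃; _×_; _,_; proj₁)
open import Data.Sum using (_⊎_; inj₁; inj₂)
open import Data.Nat as ℕ using (ℕ; zero; suc; _∸_; NonZero)
open import Data.Nat.Properties as ℕₚ using (≤-<-trans)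
open import Data.Nat.Divisibility
  using (_∣_; quotient; quotient-∣; quotient>1; m∣n⇒n≡quotient*m)
open import Data.Nat.GCD using (gcd; gcd-GCD; gcd[m,n]∣m; gcd[m,n]≤n; gcd[m,n]≢0; module Bézout)
open import Data.Fin using (Fin; fromℕ; toℕ)
import Data.Fin.Properties as Finₚ
open import Algebra.Bundles using (AbelianGroup)
import Algebra.Definitions.RawMonoid as RawMonoidDefs
open import Relation.Binary.Bundles using (Poset)
open import Relation.Binary.Structures using (IsTotalOrder)
open import Relation.Binary.PropositionalEquality as ≡ using (_≡_; _≢_)
open import Relation.Nullary using (¬_; yes; no)
open import Function.Bundles using (_⇔_; mk⇔)

module AbelianGroupMultiples {c ℓ} (G : AbelianGroup c ℓ) where
  open AbelianGroup G
  open RawMonoidDefs rawMonoid using () renaming (_×_ to _·_)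
  import Algebra.Properties.Monoid.Mult monoid as ·ₚ
  import Algebra.Properties.CommutativeMonoid.Mult commutativeMonoid as ·ᶜₚ
  import Algebra.Properties.CommutativeSemigroup commutativeSemigroup as ∙ₚ
  open import Algebra.Properties.AbelianGroup G using (inverseˡ-unique; //-rightDividesʳ)
  open import Relation.Binary.Reasoning.Setoid setoid

  infix 4 _∈_·G

  _∈_·G : Carrier → ℕ → Set (c ⊔ ℓ)
  x ∈ k ·G = ∃ λ y → x ≈ k · y

  ·-identityʳ : ∀ m → m · ε ≈ ε
  ·-identityʳ zero    = refl
  ·-identityʳ (suc m) = trans (identityˡ _) (·-identityʳ m)

  ·-inverse : ∀ m x → m · (x ⁻¹) ≈ (m · x) ⁻¹
  ·-inverse m x = inverseˡ-unique _ _ (begin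
    m · (x ⁻¹) ∙ m · x ≈⟨ ·ᶜₚ.×-distrib-+ (x ⁻¹) x m ⟨
    m · (x ⁻¹ ∙ x)     ≈⟨ ·ₚ.×-congʳ m (inverseˡ x) ⟩
    m · ε              ≈⟨ ·-identityʳ m ⟩
    ε                  ∎)

  ·-swap : ∀ m n x → m · (n · x) ≈ n · (m · x)
  ·-swap m n x = begin
    m · (n · x)   ≈⟨ ·ₚ.×-assocˡ x m n ⟩
    (m ℕ.* n) · x ≡⟨ ≡.cong (_· x) (ℕₚ.*-comm m n) ⟩
    (n ℕ.* m) · x ≈⟨ ·ₚ.×-assocˡ x n m ⟨
    n · (m · x)   ∎

  ·∈·G : ∀ n x → n · x ∈ n ·G
  ·∈·G n x = x , refl

  ∈·G-resp-≈ : ∀ {n x y} → x ≈ y → y ∈ n ·G → x ∈ n ·G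
  ∈·G-resp-≈ x≈y (z , y≈nz) = z , trans x≈y y≈nz

  ∈·G-∙-cancelʳ : ∀ {n x y} → x ∙ y ∈ n ·G → y ∈ n ·G → x ∈ n ·G
  ∈·G-∙-cancelʳ {n} {x} {y} (p , x∙y≈np) (q , y≈nq) = p ∙ q ⁻¹ , (begin
    x                  ≈⟨ //-rightDividesʳ y x ⟨
    (x ∙ y) ∙ y ⁻¹     ≈⟨ ∙-cong x∙y≈np (⁻¹-cong y≈nq) ⟩
    n · p ∙ (n · q) ⁻¹ ≈⟨ ∙-congˡ (·-inverse n q) ⟨
    n · p ∙ n · (q ⁻¹) ≈⟨ ·ᶜₚ.×-distrib-+ p (q ⁻¹) n ⟨
    n · (p ∙ q ⁻¹)     ∎)

  ∈·G-*ˡ : ∀ {n r x} m → r · x ∈ n ·G → (m ℕ.* r) · x ∈ n ·G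
  ∈·G-*ˡ {n} {r} {x} m (y , rx≈ny) = m · y , (begin
    (m ℕ.* r) · x ≈⟨ ·ₚ.×-assocˡ x m r ⟨
    m · (r · x)   ≈⟨ ·ₚ.×-congʳ m rx≈ny ⟩
    m · (n · y)   ≈⟨ ·-swap m n y ⟩
    n · (m · y)   ∎)

  ∈·G-+-cancelˡ : ∀ {n d m k x} → d ℕ.+ m ≡ k →
                  m · x ∈ n ·G → k · x ∈ n ·G → d · x ∈ n ·G
  ∈·G-+-cancelˡ {n} {d} {m} {x = x} ≡.refl mx∈ kx∈ =
    ∈·G-∙-cancelʳ {n} (∈·G-resp-≈ {n} (sym (·ₚ.×-homo-+ x d m)) kx∈) mx∈

  -- Bézout's identity over ℕ comes in two shapes, d + y r = x n and
  -- d + x n = y r; in both, d x is a difference of two elements of nG.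
  ∈·G-gcd : ∀ {n r x} → r · x ∈ n ·G → gcd n r · x ∈ n ·G
  ∈·G-gcd {n} {r} {x} rx∈ with Bézout.identity (gcd-GCD n r)
  ... | Bézout.+- p q eq =
    ∈·G-+-cancelˡ {n} {gcd n r} eq (∈·G-*ˡ {n} q rx∈) (∈·G-*ˡ {n} p (·∈·G n x))
  ... | Bézout.-+ p q eq =
    ∈·G-+-cancelˡ {n} {gcd n r} eq (∈·G-*ˡ {n} p (·∈·G n x)) (∈·G-*ˡ {n} q rx∈)

  ·-balance : ∀ {r i n g h t} → r ℕ.+ i ≡ n → r · g ∙ i · h ≈ n · t →
              n · (t ∙ h ⁻¹) ≈ r · (g ∙ h ⁻¹)
  ·-balance {r} {i} {g = g} {h} {t} ≡.refl eq = begin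
    (r ℕ.+ i) · (t ∙ h ⁻¹)                      ≈⟨ ·ᶜₚ.×-distrib-+ t (h ⁻¹) (r ℕ.+ i) ⟩
    (r ℕ.+ i) · t ∙ (r ℕ.+ i) · (h ⁻¹)          ≈⟨ ∙-cong (sym eq) (·ₚ.×-homo-+ (h ⁻¹) r i) ⟩
    (r · g ∙ i · h) ∙ (r · (h ⁻¹) ∙ i · (h ⁻¹)) ≈⟨ ∙ₚ.interchange _ _ _ _ ⟩
    (r · g ∙ r · (h ⁻¹)) ∙ (i · h ∙ i · (h ⁻¹)) ≈⟨ ∙-cong (·ᶜₚ.×-distrib-+ g (h ⁻¹) r)
                                                          (·ᶜₚ.×-distrib-+ h (h ⁻¹) i) ⟨
    r · (g ∙ h ⁻¹) ∙ i · (h ∙ h ⁻¹)             ≈⟨ ∙-congˡ (trans (·ₚ.×-congʳ i (inverseʳ h))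
                                                                 (·-identityʳ i)) ⟩
    r · (g ∙ h ⁻¹) ∙ ε                          ≈⟨ identityʳ _ ⟩
    r · (g ∙ h ⁻¹)                              ∎

module LinearlyOrderedAbelianGroupProperties
  {c ℓ₁ ℓ₂} (Γ : LinearlyOrderedAbelianGroup c ℓ₁ ℓ₂) where
  open LinearlyOrderedAbelianGroup Γ
  open AbelianGroupMultiples abelianGroup public
  import Algebra.Properties.Monoid.Mult monoid as ·ₚ
  open import Algebra.Properties.AbelianGroup abelianGroup using (//-rightDividesʳ)

  poset : Poset c ℓ₁ ℓ₂
  poset = record { isPartialOrder = IsTotalOrder.isPartialOrder isTotalOrder }

  open Poset poset using (antisym) renaming (reflexive to ≤-reflexive)
  open IsTotalOrder isTotalOrder using (total)
  open import Relation.Binary.Reasoning.PartialOrder poset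

  ∙-monoʳ-≤ : ∀ {x y} z → x ≤ y → (z ∙ x) ≤ (z ∙ y)
  ∙-monoʳ-≤ {x} {y} z x≤y = begin
    z ∙ x ≈⟨ comm z x ⟩
    x ∙ z ≤⟨ ∙-mono-≤ z x≤y ⟩
    y ∙ z ≈⟨ comm y z ⟩
    z ∙ y ∎

  ·-monoʳ-≤ : ∀ m {x y} → x ≤ y → (m · x) ≤ (m · y)
  ·-monoʳ-≤ zero    x≤y = ≤-reflexive refl
  ·-monoʳ-≤ (suc m) {x} {y} x≤y = begin
    x ∙ m · x ≤⟨ ∙-mono-≤ (m · x) x≤y ⟩
    y ∙ m · x ≤⟨ ∙-monoʳ-≤ y (·-monoʳ-≤ m x≤y) ⟩
    y ∙ m · y ∎

  ∙-cancelʳ-≤ : ∀ {x y} z → (x ∙ z) ≤ (y ∙ z) → x ≤ y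
  ∙-cancelʳ-≤ {x} {y} z x∙z≤y∙z = begin
    x              ≈⟨ //-rightDividesʳ z x ⟨
    (x ∙ z) ∙ z ⁻¹ ≤⟨ ∙-mono-≤ (z ⁻¹) x∙z≤y∙z ⟩
    (y ∙ z) ∙ z ⁻¹ ≈⟨ //-rightDividesʳ z y ⟩
    y              ∎

  ≤∧·≈⇒≥ : ∀ j {x y} → x ≤ y → suc j · x ≈ suc j · y → y ≤ x
  ≤∧·≈⇒≥ j {x} {y} x≤y eq = ∙-cancelʳ-≤ (j · x) (begin
    y ∙ j · x ≤⟨ ∙-monoʳ-≤ y (·-monoʳ-≤ j x≤y) ⟩
    y ∙ j · y ≈⟨ eq ⟨
    x ∙ j · x ∎)

  ·-cancelˡ-≈ : ∀ m .{{_ : NonZero m}} {x y} → m · x ≈ m · y → x ≈ y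
  ·-cancelˡ-≈ (suc j) {x} {y} eq with total x y
  ... | inj₁ x≤y = antisym x≤y (≤∧·≈⇒≥ j x≤y eq)
  ... | inj₂ y≤x = antisym (≤∧·≈⇒≥ j y≤x (sym eq)) y≤x

  ∈·G-cancel : ∀ {q d x} .{{_ : NonZero d}} → d · x ∈ (q ℕ.* d) ·G → x ∈ q ·G
  ∈·G-cancel {q} {d} (y , dx≈qdy) = y , ·-cancelˡ-≈ d (trans dx≈qdy (begin-equality
    (q ℕ.* d) · y ≈⟨ ·ₚ.×-assocˡ y q d ⟨
    q · (d · y)   ≈⟨ ·-swap q d y ⟩
    d · (q · y)   ∎))

  equality⇒∈·G : ∀ {n i g h t} → 1 ℕ.≤ i → i ℕ.< n →
                 (n ∸ i) · g ∙ i · h ≈ n · t →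
                 ∃ λ k → 1 ℕ.< k × k ∣ n × g ∙ h ⁻¹ ∈ k ·G
  equality⇒∈·G {n} {i} {g} {h} {t} 1≤i i<n eq =
    quotient d∣n , quotient>1 d∣n d<n , quotient-∣ d∣n , ∈·G-cancel {quotient d∣n} {d} dδ∈
    where
    r = n ∸ i
    d = gcd n r
    d∣n = gcd[m,n]∣m n r
    r<n : r ℕ.< n
    r<n = ℕₚ.∸-monoʳ-< 1≤i (ℕₚ.<⇒≤ i<n)
    instance
      r≢0 : NonZero r
      r≢0 = ℕ.>-nonZero (ℕₚ.m<n⇒0<n∸m i<n)
      d≢0 : NonZero d
      d≢0 = ℕ.≢-nonZero (gcd[m,n]≢0 n r (inj₂ (ℕ.≢-nonZero⁻¹ r)))
    d<n : d ℕ.< n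
    d<n = ≤-<-trans (gcd[m,n]≤n n r) r<n
    rδ∈ : r · (g ∙ h ⁻¹) ∈ n ·G
    rδ∈ = t ∙ h ⁻¹ , sym (·-balance {r} {i} (ℕₚ.m∸n+n≡m (ℕₚ.<⇒≤ i<n)) eq)
    dδ∈ : d · (g ∙ h ⁻¹) ∈ (quotient d∣n ℕ.* d) ·G
    dδ∈ = ≡.subst (λ m → d · (g ∙ h ⁻¹) ∈ m ·G) (m∣n⇒n≡quotient*m d∣n) (∈·G-gcd {n} {r} rδ∈)

module ExtendedProperties {c ℓ₁ ℓ₂} (Γ : LinearlyOrderedAbelianGroup c ℓ₁ ℓ₂) where
  open LinearlyOrderedAbelianGroup Γ
  open Extended Γ
  open LinearlyOrderedAbelianGroupProperties Γ

  open Poset poset using () renaming (reflexive to ≤-reflexive)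

  Indivisible : ℕ → Γ∞ → Γ∞ → Set (c ⊔ ℓ₁)
  Indivisible n z₀ zₙ = ∀ g h → z₀ ≈∞ fin g → zₙ ≈∞ fin h →
                        ∀ k → 1 ℕ.< k → k ∣ n → ¬ (g ∙ h ⁻¹ ∈ k ·G)

  indivisible⇒≉∞ : ∀ {n i} z₀ zₙ z → Indivisible n z₀ zₙ → z₀ ≢ ∞ → zₙ ≢ ∞ →
                   1 ℕ.≤ i → i ℕ.< n →
                   ¬ ((((n ∸ i) ×∞ z₀) +∞ (i ×∞ zₙ)) ≈∞ (n ×∞ z))
  indivisible⇒≉∞ ∞       _       _       _ z₀≢∞ _    _ _ _ = z₀≢∞ ≡.refl
  indivisible⇒≉∞ (fin g) ∞       _       _ _    zₙ≢∞ _ _ _ = zₙ≢∞ ≡.refl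
  indivisible⇒≉∞ (fin g) (fin h) ∞       _ _    _    _ _ (lift ())
  indivisible⇒≉∞ (fin g) (fin h) (fin t) indiv _ _ 1≤i i<n eq
    with k , 1<k , k∣n , δ∈ ← equality⇒∈·G 1≤i i<n eq
    = indiv g h refl refl k 1<k k∣n δ∈

  ≤∞-at-0 : ∀ n z₀ zₙ → zₙ ≢ ∞ → (((n ∸ 0) ×∞ z₀) +∞ (0 ×∞ zₙ)) ≤∞ (n ×∞ z₀)
  ≤∞-at-0 n ∞       _       _    = lift tt
  ≤∞-at-0 n (fin g) ∞       zₙ≢∞ = ⊥-elim (zₙ≢∞ ≡.refl)
  ≤∞-at-0 n (fin g) (fin h) _    = ≤-reflexive (identityʳ (n · g))

  ≤∞-at-n : ∀ {n m} z₀ zₙ → m ≡ n → z₀ ≢ ∞ → (((n ∸ m) ×∞ z₀) +∞ (m ×∞ zₙ)) ≤∞ (n ×∞ zₙ)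
  ≤∞-at-n ∞       _       _      z₀≢∞ = ⊥-elim (z₀≢∞ ≡.refl)
  ≤∞-at-n (fin g) ∞       _      _    = lift tt
  ≤∞-at-n {n} (fin g) (fin h) ≡.refl _ rewrite ℕₚ.n∸n≡0 n = ≤-reflexive (identityˡ (n · h))

module ValuationProperties {c ℓ c' ℓ₁ ℓ₂} {K : Field c ℓ}
                           {Γ : LinearlyOrderedAbelianGroup c' ℓ₁ ℓ₂}
                           (V : Valuation K Γ) where
  open Field K
  open Extended Γ
  open Valuation V

  ≉0⇒v≢∞ : ∀ {x} → ¬ (x ≈ 0#) → v x ≢ ∞
  ≉0⇒v≢∞ {x} x≉0 v≡∞ = x≉0 (v-∞⇒0 x (≡.subst (_≈∞ ∞) (≡.sym v≡∞) (lift tt)))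

  *≉0⇒≉0ˡ : ∀ {x y} → ¬ (x * y ≈ 0#) → ¬ (x ≈ 0#)
  *≉0⇒≉0ˡ {x} {y} xy≉0 x≈0 = xy≉0 (trans (*-congʳ x≈0) (zeroˡ y))

zero⊎interior⊎fromℕ : ∀ {n} (i : Fin (suc n)) →
                      i ≡ Fin.zero ⊎ (1 ℕ.≤ toℕ i × toℕ i ℕ.< n) ⊎ i ≡ fromℕ n
zero⊎interior⊎fromℕ Fin.zero = inj₁ ≡.refl
zero⊎interior⊎fromℕ {n} (Fin.suc j) with suc (toℕ j) ℕ.<? n
... | yes j<n = inj₂ (inj₁ (ℕ.s≤s ℕ.z≤n , j<n))
... | no  j≮n = inj₂ (inj₂ (Finₚ.toℕ-injective (≡.trans
        (ℕₚ.≤-antisym (ℕ.s≤s⁻¹ (Finₚ.toℕ<n (Fin.suc j))) (ℕₚ.≮⇒≥ j≮n))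
        (≡.sym (Finₚ.toℕ-fromℕ n)))))

lemma2p2 : ∀ {c ℓ c' ℓ₁ ℓ₂} (K : Field c ℓ) (Γ : LinearlyOrderedAbelianGroup c' ℓ₁ ℓ₂)
             (V : Valuation K Γ) (n : ℕ) (a : Fin (suc n) → Field.Carrier K) →
             ¬ (Field._≈_ K (a (fromℕ n)) (Field.0# K)) →
             let open Conditions V in
             (D0 n a × D1 n a × D2 n a) ⇔ (D0 n a × D1 n a × D2′ n a)
lemma2p2 K Γ V n a aₙ≉0 = mk⇔
  (λ (d0 , d1 , d2) → d0 , d1 , D2⇒D2′ d0 d1 d2)
  (λ (d0 , d1 , d2′) → d0 , d1 , D2′⇒D2 d0 d2′)
  where
  open Conditions V
  open Valuation V using (v)
  open Extended Γ using (∞)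
  open ExtendedProperties Γ
  open ValuationProperties V

  v₀≢∞ : D0 n a → v (a Fin.zero) ≢ ∞
  v₀≢∞ d0 = ≉0⇒v≢∞ (*≉0⇒≉0ˡ d0)

  vₙ≢∞ : v (a (fromℕ n)) ≢ ∞
  vₙ≢∞ = ≉0⇒v≢∞ aₙ≉0

  D2⇒D2′ : D0 n a → D1 n a → D2 n a → D2′ n a
  D2⇒D2′ d0 d1 d2 i 1≤i i<n = d2 i , indivisible⇒≉∞ _ _ _ d1 (v₀≢∞ d0) vₙ≢∞ 1≤i i<n

  D2′⇒D2 : D0 n a → D2′ n a → D2 n a
  D2′⇒D2 d0 d2′ i with zero⊎interior⊎fromℕ i
  ... | inj₁ ≡.refl              = ≤∞-at-0 n (v (a Fin.zero)) _ vₙ≢∞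
  ... | inj₂ (inj₁ (1≤i , i<n)) = proj₁ (d2′ i 1≤i i<n)
  ... | inj₂ (inj₂ ≡.refl)       = ≤∞-at-n _ _ (Finₚ.toℕ-fromℕ n) (v₀≢∞ d0)
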